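{- Let $r$ be an integer and let $G$ be a $(P_6+rP_3)$-free graph. Let $v\in V(G)$ be such that $G|N(v)$ is connected and bipartite, with (unique) bipartition $(A_1,A_2)$, and let $G'$ be obtained from $G$ by reducing $v$. Then $G'$ is $(P_6+rP_3)$-free.
   Context: Graphs are finite and simple; $P_6+rP_3$ is the disjoint union of a 6-vertex path and $r$ copies of the 3-vertex path; $H$-free means no induced subgraph isomorphic to $H$; $N(v)$ is the set of neighbors of $v$ and $G|A$ the induced subgraph on $A$. For $v$ with $G|N(v)$ connected and bipartite with bipartition $(A_1,A_2)$, the graph $G'$ obtained from $G$ by reducing $v$ has vertex set $(V(G)\setminus(\{v\}\cup N(v)))\cup\{a_1,a_2\}$ for two new vertices $a_1,a_2$, where $G'$ minus $\{a_1,a_2\}$ equals $G$ minus $(\{v\}\cup N(v))$, $a_1a_2\in E(G')$, and for $u\in V(G)\cap V(G')$ and $i\in\{1,2\}$, $a_iu\in E(G')$ if and only if $u$ has a neighbor in $A_i$ in $G$. -}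

module Defs where

open import Data.Nat using (ℕ; zero; suc; _+_; _*_; _≡ᵇ_)
open import Data.Fin using (Fin; toℕ; splitAt) renaming (_≟_ to _≟ᶠ_)
open import Data.Bool using (Bool; true; false; _∧_; _∨_; not; T) renaming (_≟_ to _≟ᵇ_)
open import Data.Sum using (_⊎_; inj₁; inj₂)
open import Data.Product using (Σ; _×_; _,_; proj₁)
open import Data.List using (allFin)
open import Data.Bool.ListAction using (any)
open import Relation.Nullary using (¬_)
open import Relation.Nullary.Decidable using (⌊_⌋)
open import Relation.Binary.PropositionalEquality using (_≡_; _≢_)
open import Function.Definitions using (Injective)

Graph : Set → Set
Graph V = V → V → Bool

IsSimple : {V : Set} → Graph V → Set
IsSimple {V} G = (∀ x → G x x ≡ false) × (∀ x y → G x y ≡ G y x)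

FinGraph : ℕ → Set
FinGraph k = Graph (Fin k)

ContainsInduced : {V : Set} → Graph V → {k : ℕ} → FinGraph k → Set
ContainsInduced {V} G {k} H =
  Σ (Fin k → V) λ f → Injective _≡_ _≡_ f × (∀ i j → G (f i) (f j) ≡ H i j)

Free : {V : Set} → {k : ℕ} → FinGraph k → Graph V → Set
Free H G = ¬ ContainsInduced G H

path : (k : ℕ) → FinGraph k
path k i j = ((suc (toℕ i)) ≡ᵇ toℕ j) ∨ ((suc (toℕ j)) ≡ᵇ toℕ i)

_⊕_ : {m n : ℕ} → FinGraph m → FinGraph n → FinGraph (m + n)
_⊕_ {m} G H x y with splitAt m x | splitAt m y
... | inj₁ a | inj₁ b = G a b
... | inj₂ a | inj₂ b = H a b
... | inj₁ _ | inj₂ _ = false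
... | inj₂ _ | inj₁ _ = false

copies : {k : ℕ} → (r : ℕ) → FinGraph k → FinGraph (r * k)
copies zero    H ()
copies (suc r) H = H ⊕ copies r H

P6+rP3 : (r : ℕ) → FinGraph (6 + r * 3)
P6+rP3 r = path 6 ⊕ copies r (path 3)

module _ {n : ℕ} (G : FinGraph n) where

  N : Fin n → Fin n → Bool
  N v u = G v u

  -- walks inside a vertex set S (all vertices after the start lie in S)
  data WalkIn (S : Fin n → Bool) : Fin n → Fin n → Set where
    here : ∀ {x} → WalkIn S x x
    step : ∀ {x y z} → G x y ≡ true → S y ≡ true → WalkIn S y z → WalkIn S x z

  InducedConnected : (Fin n → Bool) → Set
  InducedConnected S = ∀ x y → S x ≡ true → S y ≡ true → WalkIn S x y

  -- (A₁, A₂) is a bipartition of G|N(v), encoded by side : A₁ = {u ∈ N(v) | side u = true},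
  -- A₂ = {u ∈ N(v) | side u = false}; both parts must be stable sets.
  IsBipartitionOfN : Fin n → (Fin n → Bool) → Set
  IsBipartitionOfN v side =
    ∀ x y → N v x ≡ true → N v y ≡ true → G x y ≡ true → side x ≢ side y

  inA : Fin n → (Fin n → Bool) → Bool → Fin n → Bool
  inA v side true  u = N v u ∧ side u
  inA v side false u = N v u ∧ not (side u)

  keep : Fin n → Fin n → Bool
  keep v u = not ⌊ u ≟ᶠ v ⌋ ∧ not (N v u)

  -- vertex type of G' : new vertices a_i (inj₁ true = a₁, inj₁ false = a₂),
  -- and the kept old vertices
  RedV : Fin n → Set
  RedV v = Bool ⊎ Σ (Fin n) (λ u → T (keep v u))

  hasNbrIn : Fin n → (Fin n → Bool) → Bool → Fin n → Bool
  hasNbrIn v side i u = any (λ w → G u w ∧ inA v side i w) (allFin n)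

  reduce : (v : Fin n) → (Fin n → Bool) → Graph (RedV v)
  reduce v side (inj₁ i) (inj₁ j) = not ⌊ i ≟ᵇ j ⌋
  reduce v side (inj₁ i) (inj₂ (u , _)) = hasNbrIn v side i u
  reduce v side (inj₂ (u , _)) (inj₁ i) = hasNbrIn v side i u
  reduce v side (inj₂ (u , _)) (inj₂ (w , _)) = G u w

module Submission where

-- Any induced copy of P₆ + rP₃ in G′ lifts to one in G. Since a₁a₂ is an edge, the new vertices
-- of the copy all lie in one component, a path, where they form a block of one or two
-- consecutive vertices; the other components consist of kept vertices and are copied unchanged.
-- Inside the path, a new vertex a_b between kept neighbours x and y is replaced by a common
-- neighbour of x and y in A_b, or else by w₁ v w₂ (or w₁ w₂ when these are adjacent) with x w₁
-- and w₂ y edges; a block a_b a_b′ and a block at an end of the path are treated alike. This gives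
-- an induced path of G at least as long, and its initial segment is the lifted component. A kept
-- vertex is never adjacent to v, and is adjacent to a vertex of A_b only if it is adjacent to a_b
-- in G′, so the lifted component stays apart from the other components.

open import Defs
open import Data.Bool using (Bool; true; false; _∧_; T)
open import Data.Bool.Properties using (∨-comm; ¬-not; not-¬; T-≡; T-∧; T-irrelevant)
open import Data.Empty using (⊥-elim)
open import Data.Fin using (Fin; zero; suc; toℕ; splitAt; join; _↑ˡ_; _↑ʳ_) renaming (_≟_ to _≟ᶠ_)
open import Data.Fin.Properties using (0≢1+n; suc-injective; splitAt-↑ˡ; splitAt-↑ʳ; join-splitAt; ↑ˡ-injective; ↑ʳ-injective)
open import Data.List using (List; []; _∷_; _++_; [_]; map; take; length; lookup; tabulate; allFin)
open import Data.List.Properties using (map-++; length-++; length-map; length-take; length-tabulate)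
open import Data.List.Membership.Propositional using (_∈_; lose)
open import Data.List.Membership.Propositional.Properties using (∈-lookup; ∈-allFin)
open import Data.List.Relation.Unary.All as All using (All; []; _∷_)
open import Data.List.Relation.Unary.All.Properties using (++⁺; ++⁻; ++⁻ˡ; ++⁻ʳ; map⁺; map⁻; take⁺; tabulate⁺)
open import Data.List.Relation.Unary.Any using (here; there; satisfied)
open import Data.List.Relation.Unary.Any.Properties using (any⁺; any⁻)
open import Data.Nat using (ℕ; zero; suc; _+_; _≤_; z≤n; s≤s; _≡ᵇ_)
open import Data.Nat.Properties using (≤-refl; ≤-reflexive; ≤-trans; +-mono-≤; ≤⇒≯; m≤n⇒m⊓n≡m)
open import Data.Product using (Σ; Σ-syntax; ∃-syntax; _×_; _,_; proj₁; proj₂)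
open import Data.Sum using (_⊎_; inj₁; inj₂; [_,_]′)
open import Data.Unit using (⊤; tt)
open import Function using (_∘_)
open import Function.Bundles using (Equivalence)
open import Function.Definitions using (Injective)
open import Relation.Nullary using (¬_; yes; no)
open import Relation.Binary.PropositionalEquality using (_≡_; _≢_; refl; sym; trans; cong; cong₂; subst; subst₂)

⊕-↑ˡ-↑ˡ : ∀ {m k} (A : FinGraph m) (B : FinGraph k) i j → (A ⊕ B) (i ↑ˡ k) (j ↑ˡ k) ≡ A i j
⊕-↑ˡ-↑ˡ {m} {k} A B i j rewrite splitAt-↑ˡ m i k | splitAt-↑ˡ m j k = refl

⊕-↑ʳ-↑ʳ : ∀ {m k} (A : FinGraph m) (B : FinGraph k) i j → (A ⊕ B) (m ↑ʳ i) (m ↑ʳ j) ≡ B i j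
⊕-↑ʳ-↑ʳ {m} {k} A B i j rewrite splitAt-↑ʳ m k i | splitAt-↑ʳ m k j = refl

⊕-↑ˡ-↑ʳ : ∀ {m k} (A : FinGraph m) (B : FinGraph k) i j → (A ⊕ B) (i ↑ˡ k) (m ↑ʳ j) ≡ false
⊕-↑ˡ-↑ʳ {m} {k} A B i j rewrite splitAt-↑ˡ m i k | splitAt-↑ʳ m k j = refl

↑ˡ≢↑ʳ : ∀ {m k} (i : Fin m) (j : Fin k) → i ↑ˡ k ≢ m ↑ʳ j
↑ˡ≢↑ʳ {m} {k} i j eq with trans (sym (splitAt-↑ˡ m i k)) (trans (cong (splitAt m) eq) (splitAt-↑ʳ m k j))
... | ()

length-++-mono : ∀ {A B : Set} (xs : List A) (ys : List B) {xs′ ys′} →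
                 length xs ≤ length ys → length xs′ ≤ length ys′ → length (xs ++ xs′) ≤ length (ys ++ ys′)
length-++-mono xs ys le le′ = subst₂ _≤_ (sym (length-++ xs)) (sym (length-++ ys)) (+-mono-≤ le le′)

length-map-≤ : ∀ {A B C : Set} (f : A → B) (g : A → C) xs → length (map f xs) ≤ length (map g xs)
length-map-≤ f g xs = ≤-reflexive (trans (length-map f xs) (sym (length-map g xs)))

path-sym : ∀ k (i j : Fin k) → path k i j ≡ path k j i
path-sym k i j = ∨-comm (suc (toℕ i) ≡ᵇ toℕ j) (suc (toℕ j) ≡ᵇ toℕ i)

module InducedSubgraphs {V : Set} (E : Graph V) where

  Apart : V → V → Set
  Apart a b = E a b ≡ false × a ≢ b

  AllApart : List V → List V → Set
  AllApart xs ys = All (λ x → All (Apart x) ys) xs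

  Precedes : V → List V → Set
  Precedes x []       = ⊤
  Precedes x (y ∷ ys) = E x y ≡ true × x ≢ y × All (Apart x) ys

  IsInducedPath : List V → Set
  IsInducedPath []       = ⊤
  IsInducedPath (x ∷ xs) = Precedes x xs × IsInducedPath xs

  IsEmbedding : ∀ {m} → FinGraph m → (Fin m → V) → Set
  IsEmbedding H f = Injective _≡_ _≡_ f × (∀ i j → E (f i) (f j) ≡ H i j)

  adjacent-nonadjacent⇒≢ : ∀ {a b c} → E a b ≡ true → E a c ≡ false → b ≢ c
  adjacent-nonadjacent⇒≢ {a} ab ac b≡c = not-¬ ab (trans (cong (E a) b≡c) ac)

  AllApart-++⁻ : ∀ {xs} ys {zs} → AllApart xs (ys ++ zs) → AllApart xs ys × AllApart xs zs
  AllApart-++⁻ ys far = All.map (++⁻ˡ ys) far , All.map (++⁻ʳ ys) far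

  AllApart-++⁺ : ∀ {xs ys zs} → AllApart xs ys → AllApart xs zs → AllApart xs (ys ++ zs)
  AllApart-++⁺ []       []       = []
  AllApart-++⁺ (a ∷ as) (b ∷ bs) = ++⁺ a b ∷ AllApart-++⁺ as bs

  private
    precedes-++⁻ : ∀ {x m} xs ys → Precedes x (xs ++ m ∷ ys) → Precedes x (xs ++ [ m ]) × All (Apart x) ys
    precedes-++⁻ []       ys (e , ne , far) = (e , ne , []) , far
    precedes-++⁻ (_ ∷ xs) ys (e , ne , far) with ++⁻ xs far
    ... | far-xs , far-m ∷ far-ys = (e , ne , ++⁺ far-xs (far-m ∷ [])) , far-ys

    precedes-++⁺ : ∀ {x m} xs ys → Precedes x (xs ++ [ m ]) → All (Apart x) ys → Precedes x (xs ++ m ∷ ys)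
    precedes-++⁺ []       ys (e , ne , []) far-ys = e , ne , far-ys
    precedes-++⁺ (_ ∷ xs) ys (e , ne , far) far-ys with ++⁻ xs far
    ... | far-xs , far-m ∷ [] = e , ne , ++⁺ far-xs (far-m ∷ far-ys)

  inducedPath-++⁻ : ∀ xs m ys → IsInducedPath (xs ++ m ∷ ys) →
                    IsInducedPath (xs ++ [ m ]) × IsInducedPath (m ∷ ys) × AllApart xs ys
  inducedPath-++⁻ []       m ys p       = (tt , tt) , p , []
  inducedPath-++⁻ (x ∷ xs) m ys (h , p) with inducedPath-++⁻ xs m ys p | precedes-++⁻ xs ys h
  ... | left , right , far | h-left , h-far = (h-left , left) , right , h-far ∷ far

  inducedPath-++⁺ : ∀ xs m ys → IsInducedPath (xs ++ [ m ]) → IsInducedPath (m ∷ ys) → AllApart xs ys →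
                    IsInducedPath (xs ++ m ∷ ys)
  inducedPath-++⁺ []       m ys _        right _           = right
  inducedPath-++⁺ (x ∷ xs) m ys (h , left) right (h-far ∷ far) =
    precedes-++⁺ xs ys h h-far , inducedPath-++⁺ xs m ys left right far

  inducedPath-take : ∀ k xs → IsInducedPath xs → IsInducedPath (take k xs)
  inducedPath-take zero    xs       _       = tt
  inducedPath-take (suc k) []       _       = tt
  inducedPath-take (suc k) (x ∷ xs) (h , p) = precedes-take k xs h , inducedPath-take k xs p
    where
    precedes-take : ∀ {x} k xs → Precedes x xs → Precedes x (take k xs)
    precedes-take zero    xs       _              = tt
    precedes-take (suc k) []       _              = tt
    precedes-take (suc k) (y ∷ ys) (e , ne , far) = e , ne , take⁺ k far

  embedding⇒inducedPath : ∀ {k} {f : Fin k → V} → IsEmbedding (path k) f → IsInducedPath (tabulate f)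
  embedding⇒inducedPath {zero}        _            = tt
  embedding⇒inducedPath {suc zero}    _            = tt , tt
  embedding⇒inducedPath {suc (suc k)} (inj , adj) =
    (adj zero (suc zero) , 0≢1+n ∘ inj , tabulate⁺ (λ j → adj zero (suc (suc j)) , 0≢1+n ∘ inj)) ,
    embedding⇒inducedPath (suc-injective ∘ inj , λ i j → adj (suc i) (suc j))

  ⊕-embedding⁻ : ∀ {m k} (A : FinGraph m) (B : FinGraph k) {f} → IsEmbedding (A ⊕ B) f →
                 IsEmbedding A (f ∘ (_↑ˡ k)) × IsEmbedding B (f ∘ (m ↑ʳ_)) ×
                 (∀ i j → Apart (f (i ↑ˡ k)) (f (m ↑ʳ j)))
  ⊕-embedding⁻ {m} {k} A B (inj , adj) =
    ((λ eq → ↑ˡ-injective k _ _ (inj eq)) , λ i j → trans (adj _ _) (⊕-↑ˡ-↑ˡ A B i j)) ,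
    ((λ eq → ↑ʳ-injective m _ _ (inj eq)) , λ i j → trans (adj _ _) (⊕-↑ʳ-↑ʳ A B i j)) ,
    λ i j → trans (adj _ _) (⊕-↑ˡ-↑ʳ A B i j) , λ eq → ↑ˡ≢↑ʳ i j (inj eq)

  module _ (simple : IsSimple E) where

    adjacent-sym : ∀ {a b} → E a b ≡ true → E b a ≡ true
    adjacent-sym {a} {b} e = trans (proj₂ simple b a) e

    apart-sym : ∀ {a b} → Apart a b → Apart b a
    apart-sym {a} {b} (e , ne) = trans (proj₂ simple b a) e , ne ∘ sym

    AllApart-sym : ∀ {xs ys} → AllApart xs ys → AllApart ys xs
    AllApart-sym far = All.tabulate λ y∈ys → All.map (λ far-x → apart-sym (All.lookup far-x y∈ys)) far

    private
      first-row : ∀ x xs → Precedes x xs → ∀ j → E x (lookup xs j) ≡ path (suc (length xs)) zero (suc j)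
      first-row x (y ∷ ys) (e , _ , _)   zero    = e
      first-row x (y ∷ ys) (_ , _ , far) (suc j) = proj₁ (All.lookup far (∈-lookup j))

      first-distinct : ∀ x xs → Precedes x xs → ∀ j → x ≢ lookup xs j
      first-distinct x (y ∷ ys) (_ , ne , _)  zero    = ne
      first-distinct x (y ∷ ys) (_ , _ , far) (suc j) = proj₂ (All.lookup far (∈-lookup j))

      lookup-adjacency : ∀ xs → IsInducedPath xs → ∀ i j → E (lookup xs i) (lookup xs j) ≡ path (length xs) i j
      lookup-adjacency (x ∷ xs) _       zero    zero    = proj₁ simple x
      lookup-adjacency (x ∷ xs) (h , _) zero    (suc j) = first-row x xs h j
      lookup-adjacency (x ∷ xs) (h , _) (suc i) zero    =
        trans (proj₂ simple _ x) (trans (first-row x xs h i) (path-sym _ zero (suc i)))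
      lookup-adjacency (x ∷ xs) (_ , p) (suc i) (suc j) = lookup-adjacency xs p i j

      lookup-injective : ∀ xs → IsInducedPath xs → ∀ i j → lookup xs i ≡ lookup xs j → i ≡ j
      lookup-injective (x ∷ xs) _       zero    zero    _  = refl
      lookup-injective (x ∷ xs) (h , _) zero    (suc j) eq = ⊥-elim (first-distinct x xs h j eq)
      lookup-injective (x ∷ xs) (h , _) (suc i) zero    eq = ⊥-elim (first-distinct x xs h i (sym eq))
      lookup-injective (x ∷ xs) (_ , p) (suc i) (suc j) eq = cong suc (lookup-injective xs p i j eq)

    inducedPath⇒embedding : ∀ {k} xs → IsInducedPath xs → length xs ≡ k →
                            Σ[ g ∈ (Fin k → V) ] IsEmbedding (path k) g × (∀ j → g j ∈ xs)
    inducedPath⇒embedding xs p refl =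
      lookup xs , ((λ {i} {j} → lookup-injective xs p i j) , lookup-adjacency xs p) , ∈-lookup

    ⊕-embedding⁺ : ∀ {m k} (A : FinGraph m) (B : FinGraph k) {g h} → IsEmbedding A g → IsEmbedding B h →
                   (∀ i j → Apart (g i) (h j)) → IsEmbedding (A ⊕ B) (λ x → [ g , h ]′ (splitAt m x))
    ⊕-embedding⁺ {m} {k} A B {g} {h} (g-inj , g-adj) (h-inj , h-adj) apart = inj , adj
      where
      adj : ∀ x y → E ([ g , h ]′ (splitAt m x)) ([ g , h ]′ (splitAt m y)) ≡ (A ⊕ B) x y
      adj x y with splitAt m x | splitAt m y
      ... | inj₁ i | inj₁ j = g-adj i j
      ... | inj₁ i | inj₂ j = proj₁ (apart i j)
      ... | inj₂ i | inj₁ j = proj₁ (apart-sym (apart j i))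
      ... | inj₂ i | inj₂ j = h-adj i j

      split-injective : ∀ s t → [ g , h ]′ s ≡ [ g , h ]′ t → s ≡ t
      split-injective (inj₁ i) (inj₁ j) eq = cong inj₁ (g-inj eq)
      split-injective (inj₁ i) (inj₂ j) eq = ⊥-elim (proj₂ (apart i j) eq)
      split-injective (inj₂ i) (inj₁ j) eq = ⊥-elim (proj₂ (apart j i) (sym eq))
      split-injective (inj₂ i) (inj₂ j) eq = cong inj₂ (h-inj eq)

      inj : Injective _≡_ _≡_ (λ x → [ g , h ]′ (splitAt m x))
      inj {x} {y} eq = trans (sym (join-splitAt m k x))
        (trans (cong (join m k) (split-injective (splitAt m x) (splitAt m y) eq)) (join-splitAt m k y))

∧-true : ∀ {a b} → a ∧ b ≡ true → a ≡ true × b ≡ true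
∧-true {true} {true} _ = refl , refl

module Reduction {n : ℕ} (G : FinGraph n) (simple : IsSimple G) (v : Fin n) (side : Fin n → Bool) where

  open InducedSubgraphs G

  V′ : Set
  V′ = RedV G v

  G′ : Graph V′
  G′ = reduce G v side

  module Red = InducedSubgraphs G′

  Kept : Set
  Kept = Σ (Fin n) (T ∘ keep G v)

  old : Kept → Fin n
  old = proj₁

  pattern new b  = inj₁ b
  pattern kept u = inj₂ u

  -- A data type rather than an abbreviation, so that c can be inferred from InA c w.
  data InA (c : Bool) (w : Fin n) : Set where
    in-side : inA G v side c w ≡ true → InA c w

  old-injective : ∀ {u u′} → old u ≡ old u′ → u ≡ u′
  old-injective {u , t} {.u , t′} refl = cong (u ,_) (T-irrelevant t t′)

  old∉N[v] : ∀ u → old u ≢ v × G v (old u) ≡ false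
  old∉N[v] (u , t) with u ≟ᶠ v | G v u
  old∉N[v] (u , _)  | no u≢v | false = u≢v , refl
  old∉N[v] (u , ()) | yes _  | _
  old∉N[v] (u , ()) | no _   | true

  old≢v : ∀ u → old u ≢ v
  old≢v u = proj₁ (old∉N[v] u)

  v-old-nonadjacent : ∀ u → G v (old u) ≡ false
  v-old-nonadjacent u = proj₂ (old∉N[v] u)

  inA⇒v-adjacent : ∀ {c w} → InA c w → G v w ≡ true
  inA⇒v-adjacent {true}  (in-side i) = proj₁ (∧-true i)
  inA⇒v-adjacent {false} (in-side i) = proj₁ (∧-true i)

  inA⇒≢old : ∀ {c w} u → InA c w → w ≢ old u
  inA⇒≢old u i refl = not-¬ (inA⇒v-adjacent i) (v-old-nonadjacent u)

  old≢inA : ∀ {c w} u → InA c w → old u ≢ w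
  old≢inA u i eq = inA⇒≢old u i (sym eq)

  inA⇒≢v : ∀ {c w} → InA c w → w ≢ v
  inA⇒≢v i refl = not-¬ (inA⇒v-adjacent i) (proj₁ simple v)

  hasNbrIn⁺ : ∀ {c u w} → InA c w → G u w ≡ true → hasNbrIn G v side c u ≡ true
  hasNbrIn⁺ {c} {u} {w} (in-side i) uw = Equivalence.to T-≡
    (any⁺ (λ w → G u w ∧ inA G v side c w) (lose (∈-allFin w) (Equivalence.from T-≡ (cong₂ _∧_ uw i))))

  hasNbrIn⁻ : ∀ {c u} → hasNbrIn G v side c u ≡ true → ∃[ w ] InA c w × G u w ≡ true
  hasNbrIn⁻ {c} {u} e with satisfied (any⁻ (λ w → G u w ∧ inA G v side c w) (allFin n) (Equivalence.from T-≡ e))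
  ... | w , t with Equivalence.to T-∧ t
  ... | uw , i = w , in-side (Equivalence.to T-≡ i) , Equivalence.to T-≡ uw

  reduce-simple : IsSimple G′
  reduce-simple = irreflexive , symmetric
    where
    irreflexive : ∀ z → G′ z z ≡ false
    irreflexive (new true)      = refl
    irreflexive (new false)     = refl
    irreflexive (kept (u , _))  = proj₁ simple u

    symmetric : ∀ y z → G′ y z ≡ G′ z y
    symmetric (new true)  (new true)  = refl
    symmetric (new true)  (new false) = refl
    symmetric (new false) (new true)  = refl
    symmetric (new false) (new false) = refl
    symmetric (new _)     (kept _)    = refl
    symmetric (kept _)    (new _)     = refl
    symmetric (kept (u , _)) (kept (u′ , _)) = proj₂ simple u u′

  new-nonapart : ∀ {b c} → ¬ Red.Apart (new b) (new c)
  new-nonapart {true}  {true}  (_ , ne) = ne refl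
  new-nonapart {false} {false} (_ , ne) = ne refl
  new-nonapart {true}  {false} (() , _)
  new-nonapart {false} {true}  (() , _)

  apart-old : ∀ {u u′} → Red.Apart (kept u) (kept u′) → Apart (old u) (old u′)
  apart-old (e , ne) = e , λ eq → ne (cong kept (old-injective eq))

  apart-v : ∀ u → Apart (old u) v
  apart-v u = trans (proj₂ simple (old u) v) (v-old-nonadjacent u) , old≢v u

  apart-inA : ∀ {u c w} → Red.Apart (kept u) (new c) → InA c w → Apart (old u) w
  apart-inA {u} (e , _) i = ¬-not (λ uw → not-¬ (hasNbrIn⁺ i uw) e) , old≢inA u i

  -- The vertices of G lying under a set P of vertices of G′. It contains v whatever P is, which
  -- is harmless because no kept vertex is adjacent to v.
  data Shadow (P : V′ → Set) : Fin n → Set where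
    old-shadow  : ∀ {u} → P (kept u) → Shadow P (old u)
    centre      : Shadow P v
    side-shadow : ∀ {c w} → InA c w → P (new c) → Shadow P w

  shadow-mono : ∀ {P Q : V′ → Set} → (∀ {z} → P z → Q z) → ∀ {w} → Shadow P w → Shadow Q w
  shadow-mono P⊆Q (old-shadow p)    = old-shadow (P⊆Q p)
  shadow-mono P⊆Q centre            = centre
  shadow-mono P⊆Q (side-shadow i p) = side-shadow i (P⊆Q p)

  apart-shadow : ∀ {P u} → (∀ {z} → P z → Red.Apart (kept u) z) → ∀ {w} → Shadow P w → Apart (old u) w
  apart-shadow apart (old-shadow p)    = apart-old (apart p)
  apart-shadow {u = u} apart centre    = apart-v u
  apart-shadow apart (side-shadow i p) = apart-inA (apart p) i

  all-apart-old : ∀ {u} ks → All (Red.Apart (kept u)) (map kept ks) → All (Apart (old u)) (map old ks)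
  all-apart-old ks far = map⁺ (All.map apart-old (map⁻ far))

  inducedPath-old : ∀ ks → Red.IsInducedPath (map kept ks) → IsInducedPath (map old ks)
  inducedPath-old []       _       = tt
  inducedPath-old (u ∷ ks) (h , p) = precedes-old ks h , inducedPath-old ks p
    where
    precedes-old : ∀ ks → Red.Precedes (kept u) (map kept ks) → Precedes (old u) (map old ks)
    precedes-old []        _              = tt
    precedes-old (u′ ∷ ks) (e , ne , far) =
      e , (λ eq → ne (cong kept (old-injective eq))) , all-apart-old ks far

  inducedPath-old-∷ʳ : ∀ ks u → Red.IsInducedPath (map kept ks ++ [ kept u ]) →
                       IsInducedPath (map old ks ++ [ old u ])
  inducedPath-old-∷ʳ ks u p = subst IsInducedPath (map-++ old ks [ u ])
    (inducedPath-old (ks ++ [ u ]) (subst Red.IsInducedPath (sym (map-++ kept ks [ u ])) p))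

  shadow-old : ∀ {P} ks → All P (map kept ks) → All (Shadow P) (map old ks)
  shadow-old ks p = map⁺ (All.map old-shadow (map⁻ p))

  AllApart-old : ∀ ps qs → Red.AllApart (map kept ps) (map kept qs) → AllApart (map old ps) (map old qs)
  AllApart-old ps qs far = map⁺ (All.map (all-apart-old qs) (map⁻ far))

  AllApart-shadowˡ : ∀ ks {T B} → Red.AllApart (map kept ks) T → All (Shadow (_∈ T)) B → AllApart (map old ks) B
  AllApart-shadowˡ ks far sh = map⁺ (All.map (λ far-u → All.map (apart-shadow (All.lookup far-u)) sh) (map⁻ far))

  AllApart-shadowʳ : ∀ ks {T B} → Red.AllApart T (map kept ks) → All (Shadow (_∈ T)) B → AllApart B (map old ks)
  AllApart-shadowʳ ks {T} {B} far sh =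
    AllApart-sym simple (AllApart-shadowˡ ks {T} {B} (Red.AllApart-sym reduce-simple far) sh)

  shadow-within : ∀ {P S B} → All P S → All (Shadow (_∈ S)) B → All (Shadow P) B
  shadow-within all-S = All.map (shadow-mono (All.lookup all-S))

  data Block : List V′ → Set where
    single : ∀ b    → Block (new b ∷ [])
    double : ∀ b b′ → Block (new b ∷ new b′ ∷ [])

  block-length : ∀ {S} → Block S → length S ≤ 2
  block-length (single _)   = s≤s z≤n
  block-length (double _ _) = s≤s (s≤s z≤n)

  -- Two new vertices are equal or adjacent, so on an induced path of G′ they are consecutive.
  data Shape : List V′ → Set where
    allKept : ∀ ks → Shape (map kept ks)
    alone   : ∀ {S} → Block S → Shape S
    atStart : ∀ {S} → Block S → ∀ y qs → Shape (S ++ kept y ∷ map kept qs)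
    atEnd   : ∀ ps x {S} → Block S → Shape (map kept ps ++ kept x ∷ S)
    inner   : ∀ ps x {S} → Block S → ∀ y qs → Shape (map kept ps ++ kept x ∷ S ++ kept y ∷ map kept qs)

  kept-after-new : ∀ {b} zs → All (Red.Apart (new b)) zs → ∃[ qs ] map kept qs ≡ zs
  kept-after-new []            []        = [] , refl
  kept-after-new (new _ ∷ _)   (a ∷ _)   = ⊥-elim (new-nonapart a)
  kept-after-new (kept u ∷ zs) (_ ∷ far) with kept-after-new zs far
  ... | qs , refl = u ∷ qs , refl

  shape-from-new : ∀ b zs → Red.Precedes (new b) zs → Shape (new b ∷ zs)
  shape-from-new b []            _             = alone (single b)
  shape-from-new b (kept y ∷ zs) (_ , _ , far) with kept-after-new zs far
  ... | qs , refl = atStart (single b) y qs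
  shape-from-new b (new b′ ∷ zs) (_ , _ , far) with kept-after-new zs far
  ... | []     , refl = alone (double b b′)
  ... | y ∷ qs , refl = atStart (double b b′) y qs

  shape : ∀ zs → Red.IsInducedPath zs → Shape zs
  shape []            _       = allKept []
  shape (new b ∷ zs)  (h , _) = shape-from-new b zs h
  shape (kept u ∷ zs) (_ , p) with shape zs p
  ... | allKept ks          = allKept (u ∷ ks)
  ... | alone blk           = atEnd [] u blk
  ... | atStart blk y qs    = inner [] u blk y qs
  ... | atEnd ps x blk      = atEnd (u ∷ ps) x blk
  ... | inner ps x blk y qs = inner (u ∷ ps) x blk y qs

  Replacement : List V′ → (List (Fin n) → Set) → Set
  Replacement S Fits = Σ[ B ∈ List (Fin n) ] length S ≤ length B × Fits B × All (Shadow (_∈ S)) B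

  detour : ∀ {S} x y {c₁ c₂ w₁ w₂} → Apart (old x) (old y) →
           InA c₁ w₁ → new c₁ ∈ S → G (old x) w₁ ≡ true → Apart (old y) w₁ →
           InA c₂ w₂ → new c₂ ∈ S → G (old y) w₂ ≡ true → Apart (old x) w₂ →
           Σ[ B ∈ List (Fin n) ] 2 ≤ length B × IsInducedPath (old x ∷ B ++ [ old y ]) × All (Shadow (_∈ S)) B
  detour x y {w₁ = w₁} {w₂} x≁y i₁ m₁ x~w₁ y≁w₁ i₂ m₂ y~w₂ x≁w₂ with G w₁ w₂ in w₁-w₂
  ... | true  =
    w₁ ∷ w₂ ∷ [] , s≤s (s≤s z≤n) ,
    ((x~w₁ , old≢inA x i₁ , x≁w₂ ∷ x≁y ∷ []) ,
     (w₁-w₂ , adjacent-nonadjacent⇒≢ x~w₁ (proj₁ x≁w₂) , apart-sym simple y≁w₁ ∷ []) ,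
     (adjacent-sym simple y~w₂ , inA⇒≢old y i₂ , []) , tt , tt) ,
    side-shadow i₁ m₁ ∷ side-shadow i₂ m₂ ∷ []
  ... | false =
    w₁ ∷ v ∷ w₂ ∷ [] , s≤s (s≤s z≤n) ,
    ((x~w₁ , old≢inA x i₁ , apart-v x ∷ x≁w₂ ∷ x≁y ∷ []) ,
     (adjacent-sym simple (inA⇒v-adjacent i₁) , inA⇒≢v i₁ , (w₁-w₂ , adjacent-nonadjacent⇒≢ x~w₁ (proj₁ x≁w₂)) ∷ apart-sym simple y≁w₁ ∷ []) ,
     (inA⇒v-adjacent i₂ , (λ eq → inA⇒≢v i₂ (sym eq)) , apart-sym simple (apart-v y) ∷ []) ,
     (adjacent-sym simple y~w₂ , inA⇒≢old y i₂ , []) , tt , tt) ,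
    side-shadow i₁ m₁ ∷ centre ∷ side-shadow i₂ m₂ ∷ []

  common-neighbour : ∀ x y {b w} → Apart (old x) (old y) → InA b w → G (old x) w ≡ true → G (old y) w ≡ true →
                     Replacement (new b ∷ []) (λ B → IsInducedPath (old x ∷ B ++ [ old y ]))
  common-neighbour x y x≁y i x~w y~w =
    _ ∷ [] , s≤s z≤n ,
    ((x~w , old≢inA x i , x≁y ∷ []) , (adjacent-sym simple y~w , inA⇒≢old y i , []) , tt , tt) ,
    side-shadow i (here refl) ∷ []

  replace-inner : ∀ x {S} → Block S → ∀ y → Red.IsInducedPath (kept x ∷ S ++ [ kept y ]) →
                  Replacement S (λ B → IsInducedPath (old x ∷ B ++ [ old y ]))
  replace-inner x (single b) y ((x~b , _ , x≁y ∷ []) , (b~y , _ , []) , _)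
    with hasNbrIn⁻ x~b | hasNbrIn⁻ b~y
  ... | w₁ , i₁ , x~w₁ | w₂ , i₂ , y~w₂ with G (old y) w₁ in y-w₁ | G (old x) w₂ in x-w₂
  ... | true  | _     = common-neighbour x y (apart-old x≁y) i₁ x~w₁ y-w₁
  ... | false | true  = common-neighbour x y (apart-old x≁y) i₂ x-w₂ y~w₂
  ... | false | false =
    let B , 2≤B , fits , sh = detour x y (apart-old x≁y) i₁ (here refl) x~w₁ (y-w₁ , old≢inA y i₁)
                                                      i₂ (here refl) y~w₂ (x-w₂ , old≢inA x i₂)
    in B , ≤-trans (s≤s z≤n) 2≤B , fits , sh
  replace-inner x (double b b′) y ((x~b , _ , x≁b′ ∷ x≁y ∷ []) , (_ , _ , b≁y ∷ []) , (b′~y , _ , []) , _)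
    with hasNbrIn⁻ x~b | hasNbrIn⁻ b′~y
  ... | w₁ , i₁ , x~w₁ | w₂ , i₂ , y~w₂ =
    detour x y (apart-old x≁y) i₁ (here refl) x~w₁ (apart-inA (Red.apart-sym reduce-simple b≁y) i₁)
                               i₂ (there (here refl)) y~w₂ (apart-inA x≁b′ i₂)

  toward-centre : ∀ {S} x {c} → length S ≤ 2 → new c ∈ S → hasNbrIn G v side c (old x) ≡ true →
                  Replacement S (λ B → IsInducedPath (old x ∷ B))
  toward-centre x S≤2 m x~c with hasNbrIn⁻ x~c
  ... | w , i , x~w =
    w ∷ v ∷ [] , S≤2 ,
    ((x~w , old≢inA x i , apart-v x ∷ []) , (adjacent-sym simple (inA⇒v-adjacent i) , inA⇒≢v i , []) , tt , tt) ,
    side-shadow i m ∷ centre ∷ []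

  from-centre : ∀ {S} y {c} → length S ≤ 2 → new c ∈ S → hasNbrIn G v side c (old y) ≡ true →
                Replacement S (λ B → IsInducedPath (B ++ [ old y ]))
  from-centre y S≤2 m y~c with hasNbrIn⁻ y~c
  ... | w , i , y~w =
    v ∷ w ∷ [] , S≤2 ,
    ((inA⇒v-adjacent i , (λ eq → inA⇒≢v i (sym eq)) , apart-sym simple (apart-v y) ∷ []) ,
     (adjacent-sym simple y~w , inA⇒≢old y i , []) , tt , tt) ,
    centre ∷ side-shadow i m ∷ []

  replace-end : ∀ x {S} → Block S → Red.IsInducedPath (kept x ∷ S) →
                Replacement S (λ B → IsInducedPath (old x ∷ B))
  replace-end x blk@(single _)   ((x~b , _) , _) = toward-centre x (block-length blk) (here refl) x~b
  replace-end x blk@(double _ _) ((x~b , _) , _) = toward-centre x (block-length blk) (here refl) x~b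

  replace-start : ∀ {S} → Block S → ∀ y → Red.IsInducedPath (S ++ [ kept y ]) →
                  Replacement S (λ B → IsInducedPath (B ++ [ old y ]))
  replace-start blk@(single _)   y ((b~y , _) , _)      = from-centre y (block-length blk) (here refl) b~y
  replace-start blk@(double _ _) y (_ , (b′~y , _) , _) = from-centre y (block-length blk) (there (here refl)) b′~y

  Lift : List V′ → (V′ → Set) → Set
  Lift L P = Σ[ M ∈ List (Fin n) ] length L ≤ length M × IsInducedPath M × All (Shadow P) M

  lift-atStart : ∀ {P S} → Block S → ∀ y qs → Red.IsInducedPath (S ++ kept y ∷ map kept qs) →
                 All P (S ++ kept y ∷ map kept qs) → Lift (S ++ kept y ∷ map kept qs) P
  lift-atStart {S = S} blk y qs p all
    with Red.inducedPath-++⁻ S (kept y) (map kept qs) p | ++⁻ S all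
  ... | left , right , far | all-S , all-yqs with replace-start blk y left
  ... | B , S≤B , fits , sh =
    B ++ old y ∷ map old qs ,
    length-++-mono S B S≤B (s≤s (length-map-≤ kept old qs)) ,
    inducedPath-++⁺ B (old y) (map old qs) fits (inducedPath-old (y ∷ qs) right) (AllApart-shadowʳ qs far sh) ,
    ++⁺ (shadow-within all-S sh) (shadow-old (y ∷ qs) all-yqs)

  lift-atEnd : ∀ {P} ps x {S} → Block S → Red.IsInducedPath (map kept ps ++ kept x ∷ S) →
               All P (map kept ps ++ kept x ∷ S) → Lift (map kept ps ++ kept x ∷ S) P
  lift-atEnd ps x {S} blk p all
    with Red.inducedPath-++⁻ (map kept ps) (kept x) S p | ++⁻ (map kept ps) all
  ... | left , right , far | all-ps , all-x ∷ all-S with replace-end x blk right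
  ... | B , S≤B , fits , sh =
    map old ps ++ old x ∷ B ,
    length-++-mono (map kept ps) (map old ps) (length-map-≤ kept old ps) (s≤s S≤B) ,
    inducedPath-++⁺ (map old ps) (old x) B (inducedPath-old-∷ʳ ps x left) fits (AllApart-shadowˡ ps far sh) ,
    ++⁺ (shadow-old ps all-ps) (old-shadow all-x ∷ shadow-within all-S sh)

  lift-inner : ∀ {P} ps x {S} → Block S → ∀ y qs →
               Red.IsInducedPath (map kept ps ++ kept x ∷ S ++ kept y ∷ map kept qs) →
               All P (map kept ps ++ kept x ∷ S ++ kept y ∷ map kept qs) →
               Lift (map kept ps ++ kept x ∷ S ++ kept y ∷ map kept qs) P
  lift-inner ps x {S} blk y qs p all
    with Red.inducedPath-++⁻ (map kept ps) (kept x) (S ++ kept y ∷ map kept qs) p | ++⁻ (map kept ps) all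
  ... | left , right , far | all-ps , all-x ∷ all-rest
    with Red.inducedPath-++⁻ (kept x ∷ S) (kept y) (map kept qs) right | ++⁻ S all-rest | Red.AllApart-++⁻ S far
  ... | middle , right′ , far-x ∷ far-S | all-S , all-yqs | far-ps-S , far-ps-yqs
    with replace-inner x blk y middle
  ... | B , S≤B , fits , sh =
    map old ps ++ old x ∷ B ++ old y ∷ map old qs ,
    length-++-mono (map kept ps) (map old ps) (length-map-≤ kept old ps)
      (s≤s (length-++-mono S B S≤B (s≤s (length-map-≤ kept old qs)))) ,
    inducedPath-++⁺ (map old ps) (old x) (B ++ old y ∷ map old qs) (inducedPath-old-∷ʳ ps x left)
      (inducedPath-++⁺ (old x ∷ B) (old y) (map old qs) fits (inducedPath-old (y ∷ qs) right′)
        (all-apart-old qs far-x ∷ AllApart-shadowʳ qs far-S sh))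
      (AllApart-++⁺ (AllApart-shadowˡ ps far-ps-S sh) (AllApart-old ps (y ∷ qs) far-ps-yqs)) ,
    ++⁺ (shadow-old ps all-ps) (old-shadow all-x ∷ ++⁺ (shadow-within all-S sh) (shadow-old (y ∷ qs) all-yqs))

  lift-path : ∀ {P} L → Red.IsInducedPath L → 3 ≤ length L → All P L → Lift L P
  lift-path L p 3≤L all with shape L p
  ... | allKept ks          = map old ks , length-map-≤ kept old ks , inducedPath-old ks p , shadow-old ks all
  ... | alone blk           = ⊥-elim (≤⇒≯ (block-length blk) 3≤L)
  ... | atStart blk y qs    = lift-atStart blk y qs p all
  ... | atEnd ps x blk      = lift-atEnd ps x blk p all
  ... | inner ps x blk y qs = lift-inner ps x blk y qs p all

  Image : ∀ {m} → (Fin m → V′) → V′ → Set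
  Image f z = ∃[ i ] f i ≡ z

  Liftable : ∀ {m} → FinGraph m → Set
  Liftable {m} H = ∀ f → Red.IsEmbedding H f →
                   Σ[ g ∈ (Fin m → Fin n) ] IsEmbedding H g × (∀ j → Shadow (Image f) (g j))

  -- The lifted path may be longer than k, so only its first k vertices are kept.
  path-liftable : ∀ k → 3 ≤ k → Liftable (path k)
  path-liftable k 3≤k f f-emb =
    let M , L≤M , M-path , M-shadow = lift-path (tabulate f) (Red.embedding⇒inducedPath f-emb)
                                        (subst (3 ≤_) (sym (length-tabulate f)) 3≤k) (tabulate⁺ (λ i → i , refl))
        k≤M = subst (_≤ length M) (length-tabulate f) L≤M
        g , g-emb , g∈M = inducedPath⇒embedding simple (take k M) (inducedPath-take k M M-path)
                            (trans (length-take k M) (m≤n⇒m⊓n≡m k≤M))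
    in g , g-emb , λ j → All.lookup (take⁺ k M-shadow) (g∈M j)

  empty-liftable : (H : FinGraph 0) → Liftable H
  empty-liftable H f _ = (λ ()) , ((λ { {()} }) , λ ()) , λ ()

  kept-or-new : ∀ {m} (h : Fin m → V′) → (∀ i → ∃[ u ] h i ≡ kept u) ⊎ (∃[ i ] ∃[ b ] h i ≡ new b)
  kept-or-new {zero}  h = inj₁ λ ()
  kept-or-new {suc m} h with h zero in e | kept-or-new (h ∘ suc)
  ... | new b  | _                = inj₂ (zero , b , e)
  ... | kept u | inj₂ (i , b , e′) = inj₂ (suc i , b , e′)
  ... | kept u | inj₁ ks          = inj₁ λ { zero → u , e ; (suc i) → ks i }

  kept-embedding : ∀ {m} {H : FinGraph m} {h} → Red.IsEmbedding H h → (ks : ∀ i → ∃[ u ] h i ≡ kept u) →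
                   IsEmbedding H (old ∘ proj₁ ∘ ks)
  kept-embedding (inj , adj) ks =
    (λ {i} {j} eq → inj (trans (proj₂ (ks i)) (trans (cong kept (old-injective eq)) (sym (proj₂ (ks j)))))) ,
    λ i j → trans (cong₂ G′ (sym (proj₂ (ks i))) (sym (proj₂ (ks j)))) (adj i j)

  kept-shadow : ∀ {m} {h : Fin m → V′} (ks : ∀ i → ∃[ u ] h i ≡ kept u) → ∀ i → Shadow (Image h) (old (proj₁ (ks i)))
  kept-shadow ks i = old-shadow (i , proj₂ (ks i))

  apart-image : ∀ {m u} {h : Fin m → V′} → (∀ j → Red.Apart (kept u) (h j)) → ∀ {z} → Image h z → Red.Apart (kept u) z
  apart-image apart (j , refl) = apart j

  ⊕-shadow : ∀ {m k} {f : Fin (m + k) → V′} {g h} →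
             (∀ (i : Fin m) → Shadow (Image (f ∘ (_↑ˡ k))) (g i)) → (∀ (j : Fin k) → Shadow (Image (f ∘ (m ↑ʳ_))) (h j)) →
             ∀ x → Shadow (Image f) ([ g , h ]′ (splitAt m x))
  ⊕-shadow {m} {k} g-sh h-sh x with splitAt m x
  ... | inj₁ i = shadow-mono (λ { (i′ , e) → i′ ↑ˡ k , e }) (g-sh i)
  ... | inj₂ j = shadow-mono (λ { (j′ , e) → m ↑ʳ j′ , e }) (h-sh j)

  -- New vertices are never apart, so one of the two sides consists of kept vertices only.
  ⊕-liftable : ∀ {m k} {A : FinGraph m} {B : FinGraph k} → Liftable A → Liftable B → Liftable (A ⊕ B)
  ⊕-liftable {m} {k} {A} {B} lift-A lift-B f f-emb
    with Red.⊕-embedding⁻ A B f-emb | kept-or-new (f ∘ (_↑ˡ k)) | kept-or-new (f ∘ (m ↑ʳ_))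
  ... | _ , _ , apart | inj₂ (i , _ , eb) | inj₂ (j , _ , ec) =
    ⊥-elim (new-nonapart (subst₂ Red.Apart eb ec (apart i j)))
  ... | A-emb , B-emb , apart | inj₁ ks | _ =
    let g , g-emb , g-sh = lift-B _ B-emb
        apart-ks : ∀ i j → Red.Apart (kept (proj₁ (ks i))) (f (m ↑ʳ j))
        apart-ks i j = subst (λ z → Red.Apart z (f (m ↑ʳ j))) (proj₂ (ks i)) (apart i j)
    in _ , ⊕-embedding⁺ simple A B (kept-embedding A-emb ks) g-emb
             (λ i j → apart-shadow (apart-image (apart-ks i)) (g-sh j)) ,
       ⊕-shadow (kept-shadow ks) g-sh
  ... | A-emb , B-emb , apart | inj₂ _ | inj₁ ks =
    let g , g-emb , g-sh = lift-A _ A-emb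
        apart-ks : ∀ j i → Red.Apart (kept (proj₁ (ks j))) (f (i ↑ˡ k))
        apart-ks j i = subst (λ z → Red.Apart z (f (i ↑ˡ k))) (proj₂ (ks j)) (Red.apart-sym reduce-simple (apart i j))
    in _ , ⊕-embedding⁺ simple A B g-emb (kept-embedding B-emb ks)
             (λ i j → apart-sym simple (apart-shadow (apart-image (apart-ks j)) (g-sh i))) ,
       ⊕-shadow g-sh (kept-shadow ks)

  copies-liftable : ∀ {k} {H : FinGraph k} r → Liftable H → Liftable (copies r H)
  copies-liftable zero    _      = empty-liftable _
  copies-liftable (suc r) lift-H = ⊕-liftable lift-H (copies-liftable r lift-H)

  P6+rP3-liftable : ∀ r → Liftable (P6+rP3 r)
  P6+rP3-liftable r =
    ⊕-liftable (path-liftable 6 (s≤s (s≤s (s≤s z≤n)))) (copies-liftable r (path-liftable 3 ≤-refl))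

theorem5p1 : (r n : ℕ) (G : FinGraph n) → IsSimple G →
    Free (P6+rP3 r) G →
    (v : Fin n) (side : Fin n → Bool) →
    InducedConnected G (N G v) →
    IsBipartitionOfN G v side →
    Free (P6+rP3 r) (reduce G v side)
theorem5p1 r n G simple free v side _ _ (f , f-emb) with Reduction.P6+rP3-liftable G simple v side r f f-emb
... | g , g-emb , _ = free (g , g-emb)
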